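{- Let $t\ge 3$ and $1\le n_1\le\cdots\le n_t$ be integers, let $m=\sum_{i=1}^{t-1}n_i$ and $n=n_t$. Then $strc(K_{n_1,\dots,n_t})=1$ if $n=1$; $strc(K_{n_1,\dots,n_t})=3$ if $n\ge 2$ and $m>n$; and $strc(K_{n_1,\dots,n_t})=\lceil\sqrt[m]{n}\,\rceil+1$ if $m\le n$.
   Context: All graphs are finite and simple; $K_{n_1,\dots,n_t}$ is the complete multipartite graph with $t$ classes of sizes $n_1,\dots,n_t$. A total-coloured path (vertices and edges coloured) is total-rainbow if its edges and internal vertices have pairwise distinct colours. $strc(G)$ is the minimum number of colours in a total-colouring of $G$ in which any two vertices $u,v$ are joined by a total-rainbow $u$–$v$ geodesic (a $u$–$v$ path of length $d(u,v)$). -}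

module Defs where

open import Data.Nat using (ℕ; zero; suc; _+_; _≤_; _<_)
open import Data.Fin using (Fin; zero; suc; inject₁; fromℕ)
open import Data.List using (List; []; _∷_)
open import Data.List.Relation.Unary.Unique.Propositional using (Unique)
open import Data.Product using (Σ; _×_; _,_; ∃)
open import Relation.Binary.PropositionalEquality using (_≡_; _≢_)
open import Relation.Nullary using (¬_)

module _ {V : Set} (Adj : V → V → Set) where

  data Walk : V → V → Set where
    [] : ∀ {u} → Walk u u
    step : ∀ {u} (w : V) {v} → Adj u w → Walk w v → Walk u v

  walkLength : ∀ {u v} → Walk u v → ℕ
  walkLength [] = 0
  walkLength (step _ _ p) = suc (walkLength p)

  vertices : ∀ {u v} → Walk u v → List V
  vertices {u} [] = u ∷ []
  vertices {u} (step _ _ p) = u ∷ vertices p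

  IsPath : ∀ {u v} → Walk u v → Set
  IsPath p = Unique (vertices p)

  IsGeodesic : ∀ {u v} → Walk u v → Set
  IsGeodesic {u} {v} p = IsPath p × (∀ (q : Walk u v) → IsPath q → walkLength p ≤ walkLength q)

  -- total colourings with colours from Fin k; edge colours are given on
  -- ordered adjacent pairs and are required to depend only on the
  -- unordered edge
  record TotalColouring (k : ℕ) : Set where
    field
      vcol : V → Fin k
      ecol : (u v : V) → Adj u v → Fin k
      ecol-sym : ∀ u v (a : Adj u v) (b : Adj v u) → ecol u v a ≡ ecol v u b

  module _ {k : ℕ} (c : TotalColouring k) where
    open TotalColouring c

    totalColours : ∀ {u v} → Walk u v → List (Fin k)
    totalColours [] = []
    totalColours {u} (step w a []) = ecol u w a ∷ []
    totalColours {u} (step w a p@(step _ _ _)) = ecol u w a ∷ vcol w ∷ totalColours p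

    IsTotalRainbow : ∀ {u v} → Walk u v → Set
    IsTotalRainbow p = Unique (totalColours p)

  StronglyTotalRainbowConnectable : ℕ → Set
  StronglyTotalRainbowConnectable k =
    Σ (TotalColouring k) λ c → ∀ (u v : V) →
      Σ (Walk u v) λ p → IsGeodesic p × IsTotalRainbow c p

  StrcIs : ℕ → Set
  StrcIs N = StronglyTotalRainbowConnectable N
           × (∀ k → k < N → ¬ StronglyTotalRainbowConnectable k)

MVertex : ∀ {t} → (Fin t → ℕ) → Set
MVertex {t} ns = Σ (Fin t) λ i → Fin (ns i)

MAdj : ∀ {t} (ns : Fin t → ℕ) → MVertex ns → MVertex ns → Set
MAdj ns (i , _) (j , _) = i ≢ j

sumFin : ∀ {k} → (Fin k → ℕ) → ℕ
sumFin {zero} f = 0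
sumFin {suc k} f = f zero + sumFin (λ i → f (suc i))

-- r = ⌈ n^(1/m) ⌉ : the least natural r with n ≤ r^m
IsCeilRoot : ℕ → ℕ → ℕ → Set
IsCeilRoot m n r = n ≤ r Data.Nat.^ m × (∀ s → s < r → ¬ (n ≤ s Data.Nat.^ m))

module Submission where

-- Call the last class (size n, the largest) "big" and the m vertices of the other
-- classes "small".  Vertices of different classes are adjacent, so a colouring is
-- strong as soon as any two distinct vertices of one class are joined by a
-- total-rainbow path of length 2 (strongFromSameClass); for n = 1 there are no such
-- pairs and one colour suffices (singletonClasses).
--
-- Given a separating code, i.e. words  word a : small vertices → Fin k
-- for the big vertices a such that distinct big vertices get distinct words and any two
-- small vertices of one class are told apart by some word, colour every vertex and
-- every small–small edge 0 and the edge a–P by 1 + word a P (codeColouring); this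
-- uses k + 1 colours.  For m > n the residues mod n give a binary code (residueCode),
-- for m ≤ n ≤ r^m "bumped" base-r digits give a code over r letters (digitCode).
--
-- Some vertex needs a colour; two big vertices are at distance 2, so
-- their rainbow geodesic carries 3 colours; and with k + 2 colours, recording for each
-- big vertex a the colours of its edges to the small vertices, relabelled into k + 1
-- letters by punching out the colour of the small vertex, is injective
-- (bigSize≤power), so n ≤ (k+1)^m and the minimality of r = ⌈n^(1/m)⌉ gives k+1 ≥ r.

open import Defs
open import Data.Nat using (ℕ; zero; suc; _+_; _*_; _^_; _≤_; _<_; _≥_; _>_; z≤n; s≤s; s≤s⁻¹; NonZero; >-nonZero; _%_; _/_)
open import Data.Nat.Properties
open import Data.Nat.DivMod using (m≡m%n+[m/n]*n; m%n<n; m<n⇒m%n≡m)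
open import Data.Fin using (Fin; zero; suc; inject₁; fromℕ; toℕ; fromℕ<; inject≤; _↑ˡ_; _↑ʳ_; splitAt; quotient; remainder; combine; funToFin; finToFun)
open import Data.Fin.Base using () renaming (_≤_ to _≤ᶠ_)
import Data.Fin as F
import Data.Fin.Properties as FP
open import Data.List using ([]; _∷_)
open import Data.List.Relation.Unary.All using ([]; _∷_)
open import Data.List.Relation.Unary.AllPairs using ([]; _∷_)
open import Data.List.Relation.Unary.Unique.Propositional using (Unique)
open import Data.Product using (Σ; _×_; _,_; proj₁; proj₂)
open import Data.Sum using (inj₁; inj₂)
open import Data.Empty using (⊥; ⊥-elim)
open import Relation.Binary.PropositionalEquality
open import Relation.Binary.Definitions using (tri<; tri≈; tri>)
open import Relation.Nullary using (¬_; Dec; yes; no)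

-- The snoc view of Fin (suc m): an index is the last one or an injected one.  Class
-- indices are split this way into the big class (fromℕ s) and the small ones.
data LastView : {m : ℕ} → Fin (suc m) → Set where
  last : ∀ {m} → LastView {m} (fromℕ m)
  earlier : ∀ {m} (j : Fin m) → LastView {m} (inject₁ j)

lastView : ∀ {m} (j : Fin (suc m)) → LastView j
lastView {zero} zero = last
lastView {suc m} zero = earlier zero
lastView {suc m} (suc j) with lastView j
... | last = last
... | earlier j' = earlier (suc j')

lastView-last : ∀ m → lastView (fromℕ m) ≡ last
lastView-last zero = refl
lastView-last (suc m) rewrite lastView-last m = refl

lastView-earlier : ∀ {m} (j : Fin m) → lastView (inject₁ j) ≡ earlier j
lastView-earlier {suc m} zero = refl
lastView-earlier {suc m} (suc j) rewrite lastView-earlier j = refl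

distinct3 : ∀ {A : Set} {x y z : A} → x ≢ y → x ≢ z → y ≢ z → Unique (x ∷ y ∷ z ∷ [])
distinct3 x≢y x≢z y≢z = (x≢y ∷ x≢z ∷ []) ∷ (y≢z ∷ []) ∷ [] ∷ []

noThreeDistinct : ∀ {k} → k ≤ 2 → {x y z : Fin k} → Unique (x ∷ y ∷ z ∷ []) → ⊥
noThreeDistinct {zero} _ {()}
noThreeDistinct {suc zero} _ {zero} {zero} ((x≢y ∷ _) ∷ _) = x≢y refl
noThreeDistinct {suc (suc zero)} _ {zero} {zero} ((x≢y ∷ _) ∷ _) = x≢y refl
noThreeDistinct {suc (suc zero)} _ {suc zero} {suc zero} ((x≢y ∷ _) ∷ _) = x≢y refl
noThreeDistinct {suc (suc zero)} _ {zero} {suc zero} {zero} ((_ ∷ x≢z ∷ []) ∷ _) = x≢z refl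
noThreeDistinct {suc (suc zero)} _ {zero} {suc zero} {suc zero} (_ ∷ (y≢z ∷ []) ∷ _) = y≢z refl
noThreeDistinct {suc (suc zero)} _ {suc zero} {zero} {zero} (_ ∷ (y≢z ∷ []) ∷ _) = y≢z refl
noThreeDistinct {suc (suc zero)} _ {suc zero} {zero} {suc zero} ((_ ∷ x≢z ∷ []) ∷ _) = x≢z refl
noThreeDistinct {suc (suc (suc k))} (s≤s (s≤s ()))

-- Relabel a colour e of Fin (2+b) into Fin (1+b) by punching out a colour v; this is
-- injective on the colours different from v (the value at e = v is irrelevant).
relabel : ∀ {b} → Fin (suc (suc b)) → Fin (suc (suc b)) → Fin (suc b)
relabel v e with v F.≟ e
... | yes _ = zero
... | no v≢e = F.punchOut v≢e

relabel-injective : ∀ {b} {v e e' : Fin (suc (suc b))} → v ≢ e → v ≢ e' →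
  relabel v e ≡ relabel v e' → e ≡ e'
relabel-injective {v = v} {e} {e'} v≢e v≢e' eq with v F.≟ e | v F.≟ e'
... | yes v≡e | _ = ⊥-elim (v≢e v≡e)
... | no _ | yes v≡e' = ⊥-elim (v≢e' v≡e')
... | no p | no q = FP.punchOut-injective p q eq

indicator : ∀ {X : Set} → Dec X → Fin 2
indicator (yes _) = suc zero
indicator (no _) = zero

indicator-differs : ∀ {X Y : Set} (x? : Dec X) (y? : Dec Y) → X → ¬ Y → indicator x? ≢ indicator y?
indicator-differs (yes _) (no _) _ _ ()
indicator-differs (yes _) (yes y) _ ¬y _ = ¬y y
indicator-differs (no ¬x) _ x _ _ = ¬x x

ceilRoot≥2 : ∀ {m n r} → 2 ≤ n → n ≤ r ^ m → 2 ≤ r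
ceilRoot≥2 {m} {n} {r} n≥2 n≤r^m with r ≤? 1
... | no r≰1 = ≰⇒> r≰1
... | yes r≤1 = ⊥-elim (<⇒≱ n≥2 (≤-trans n≤r^m (subst (r ^ m ≤_) (^-zeroˡ m) (^-monoˡ-≤ m r≤1))))

distinctWords⇒≤ : ∀ {n m k} (word : Fin n → Fin m → Fin k) →
  (∀ a a' → a ≢ a' → Σ (Fin m) λ P → word a P ≢ word a' P) → n ≤ k ^ m
distinctWords⇒≤ word separated = FP.injective⇒≤ {f = λ a → funToFin (word a)} encoding-injective
  where
  encoding-injective : ∀ {a a'} → funToFin (word a) ≡ funToFin (word a') → a ≡ a'
  encoding-injective {a} {a'} eq with a F.≟ a'
  ... | yes a≡a' = a≡a'
  ... | no a≢a' with separated a a' a≢a'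
  ...   | P , differ = ⊥-elim (differ (begin
    word a P                       ≡⟨ FP.finToFun-funToFin (word a) P ⟨
    finToFun (funToFin (word a)) P  ≡⟨ cong (λ code → finToFun code P) eq ⟩
    finToFun (funToFin (word a')) P ≡⟨ FP.finToFun-funToFin (word a') P ⟩
    word a' P                      ∎))
    where open ≡-Reasoning

-- Of o + x < o + y with the same residue mod n, the second exceeds the first by a
-- multiple of n, hence y ≥ n.
sameResidue⇒≥ : ∀ n .{{_ : NonZero n}} o {x y} → x < y → (o + x) % n ≡ (o + y) % n → n ≤ y
sameResidue⇒≥ n o {x} {y} x<y same = ≤-trans (m≤n+m n x) (+-cancelˡ-≤ o _ _ a+n≤b)
  where
  a = o + x
  b = o + y
  a≡ : a ≡ a % n + (a / n) * n
  a≡ = m≡m%n+[m/n]*n a n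
  b≡ : b ≡ a % n + (b / n) * n
  b≡ = trans (m≡m%n+[m/n]*n b n) (cong (_+ (b / n) * n) (sym same))
  quotients< : a / n < b / n
  quotients< = *-cancelʳ-< n (a / n) (b / n)
    (+-cancelˡ-< (a % n) _ _ (subst₂ _<_ a≡ b≡ (+-monoʳ-< o x<y)))
  a+n≤b : o + (x + n) ≤ o + y
  a+n≤b = begin
    o + (x + n)              ≡⟨ +-assoc o x n ⟨
    a + n                    ≡⟨ cong (_+ n) a≡ ⟩
    a % n + (a / n) * n + n  ≡⟨ +-assoc (a % n) _ n ⟩
    a % n + ((a / n) * n + n) ≡⟨ cong (a % n +_) (+-comm ((a / n) * n) n) ⟩
    a % n + suc (a / n) * n  ≤⟨ +-monoʳ-≤ (a % n) (*-monoˡ-≤ n quotients<) ⟩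
    a % n + (b / n) * n      ≡⟨ b≡ ⟨
    b                        ∎
    where open ≤-Reasoning

residue-injective : ∀ n .{{_ : NonZero n}} o {x y} → x < n → y < n → x ≢ y →
  (o + x) % n ≢ (o + y) % n
residue-injective n o {x} {y} x<n y<n x≢y same with <-cmp x y
... | tri< x<y _ _ = <⇒≱ y<n (sameResidue⇒≥ n o x<y same)
... | tri≈ _ x≡y _ = x≢y x≡y
... | tri> _ _ y<x = <⇒≱ x<n (sameResidue⇒≥ n o y<x (sym same))

-- The disjoint union Σ i, Fin (f i) is enumerated by Fin (sumFin f), class by class.
module SumEncoding where
  encode : ∀ {k} (f : Fin k → ℕ) (i : Fin k) → Fin (f i) → Fin (sumFin f)
  encode {suc k} f zero x = x ↑ˡ sumFin (λ i → f (suc i))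
  encode {suc k} f (suc i) x = f zero ↑ʳ encode (λ i → f (suc i)) i x

  decode : ∀ {k} (f : Fin k → ℕ) → Fin (sumFin f) → Σ (Fin k) λ i → Fin (f i)
  decode {suc k} f P with splitAt (f zero) P
  ... | inj₁ x = zero , x
  ... | inj₂ Q with decode (λ i → f (suc i)) Q
  ...   | (i , y) = suc i , y

  decode-encode : ∀ {k} (f : Fin k → ℕ) i x → decode f (encode f i x) ≡ (i , x)
  decode-encode {suc k} f zero x
    rewrite FP.splitAt-↑ˡ (f zero) x (sumFin (λ i → f (suc i))) = refl
  decode-encode {suc k} f (suc i) x
    rewrite FP.splitAt-↑ʳ (f zero) (sumFin (λ i → f (suc i))) (encode (λ i → f (suc i)) i x)
          | decode-encode (λ i → f (suc i)) i x = refl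

  encode-decode : ∀ {k} (f : Fin k → ℕ) P → encode f (proj₁ (decode f P)) (proj₂ (decode f P)) ≡ P
  encode-decode {suc k} f P with splitAt (f zero) P in split
  ... | inj₁ x = FP.splitAt⁻¹-↑ˡ split
  ... | inj₂ Q with decode (λ i → f (suc i)) Q in dec
  ...   | (i , y) = trans (cong (f zero ↑ʳ_) rest) (FP.splitAt⁻¹-↑ʳ split)
    where
    rest : encode (λ i → f (suc i)) i y ≡ Q
    rest = trans (cong (λ d → encode (λ i → f (suc i)) (proj₁ d) (proj₂ d)) (sym dec))
                 (encode-decode (λ i → f (suc i)) Q)

  offset : ∀ {k} (f : Fin k → ℕ) → Fin k → ℕ
  offset {suc k} f zero = 0
  offset {suc k} f (suc i) = f zero + offset (λ i → f (suc i)) i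

  toℕ-encode : ∀ {k} (f : Fin k → ℕ) i x → toℕ (encode f i x) ≡ offset f i + toℕ x
  toℕ-encode {suc k} f zero x = FP.toℕ-↑ˡ x _
  toℕ-encode {suc k} f (suc i) x = begin
    toℕ (f zero ↑ʳ encode g i x)         ≡⟨ FP.toℕ-↑ʳ (f zero) _ ⟩
    f zero + toℕ (encode g i x)          ≡⟨ cong (f zero +_) (toℕ-encode g i x) ⟩
    f zero + (offset g i + toℕ x)        ≡⟨ +-assoc (f zero) _ _ ⟨
    f zero + offset g i + toℕ x          ∎
    where
    open ≡-Reasoning
    g : Fin k → ℕ
    g i = f (suc i)

  encode-injective : ∀ {k} (f : Fin k → ℕ) i {x y} → encode f i x ≡ encode f i y → x ≡ y
  encode-injective f i {x} {y} eq = FP.toℕ-injective (+-cancelˡ-≡ (offset f i) _ _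
    (trans (sym (toℕ-encode f i x)) (trans (cong toℕ eq) (toℕ-encode f i y))))

  classes≤sum : ∀ {k} (f : Fin k → ℕ) → (∀ i → 1 ≤ f i) → k ≤ sumFin f
  classes≤sum {zero} f nonempty = z≤n
  classes≤sum {suc k} f nonempty =
    +-mono-≤ (nonempty zero) (classes≤sum (λ i → f (suc i)) (λ i → nonempty (suc i)))

module _ {V : Set} {Adj : V → V → Set} where

  RainbowVia : ∀ {k} → TotalColouring Adj k → V → V → V → Set
  RainbowVia c u w v = Σ (Adj u w) λ a → Σ (Adj w v) λ b →
    Unique (ecol u w a ∷ vcol w ∷ ecol w v b ∷ [])
    where open TotalColouring c

  length≥1 : ∀ {u v} (q : Walk Adj u v) → u ≢ v → 1 ≤ walkLength Adj q
  length≥1 [] u≢v = ⊥-elim (u≢v refl)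
  length≥1 (step _ _ _) _ = s≤s z≤n

  length≥2 : ∀ {u v} (q : Walk Adj u v) → u ≢ v → ¬ Adj u v → 2 ≤ walkLength Adj q
  length≥2 [] u≢v _ = ⊥-elim (u≢v refl)
  length≥2 (step w a []) _ ¬a = ⊥-elim (¬a a)
  length≥2 (step w a (step _ _ _)) _ _ = s≤s (s≤s z≤n)

  rainbowMiddle : ∀ {k} (c : TotalColouring Adj k) {u v} (p : Walk Adj u v) →
    walkLength Adj p ≤ 2 → u ≢ v → ¬ Adj u v → IsTotalRainbow Adj c p →
    Σ V λ w → RainbowVia c u w v
  rainbowMiddle c [] _ u≢v _ _ = ⊥-elim (u≢v refl)
  rainbowMiddle c (step w a []) _ _ ¬a _ = ⊥-elim (¬a a)
  rainbowMiddle c (step w a (step _ b [])) _ _ _ rainbow = w , a , b , rainbow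
  rainbowMiddle c (step _ _ (step _ _ (step _ _ _))) (s≤s (s≤s ()))

  ecol-irrelevant : ∀ {k} (c : TotalColouring Adj k) → (∀ {u w} → Adj u w → Adj w u) →
    ∀ {u w} (a a' : Adj u w) → TotalColouring.ecol c u w a ≡ TotalColouring.ecol c u w a'
  ecol-irrelevant c sym-adj {u} {w} a a' =
    trans (ecol-sym u w a (sym-adj a)) (sym (ecol-sym u w a' (sym-adj a)))
    where open TotalColouring c

module Multipartite {t : ℕ} (ns : Fin t → ℕ) where
  V : Set
  V = MVertex ns

  A : V → V → Set
  A = MAdj ns

  adj-sym : ∀ {u w} → A u w → A w u
  adj-sym u≁w eq = u≁w (sym eq)

  SameClassRainbow : ∀ {k} → TotalColouring A k → Set
  SameClassRainbow c = ∀ i (x y : Fin (ns i)) → x ≢ y → Σ V λ w → RainbowVia c (i , x) w (i , y)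

  -- Vertices of different classes are adjacent, so such a colouring is strong.
  strongFromSameClass : ∀ {k} (c : TotalColouring A k) → SameClassRainbow c →
    StronglyTotalRainbowConnectable A k
  strongFromSameClass c sameClass = c , geodesic
    where
    geodesic : (u v : V) → Σ (Walk A u v) λ p → IsGeodesic A p × IsTotalRainbow A c p
    geodesic (i , x) (j , y) with i F.≟ j
    ... | no i≢j = step (j , y) i≢j [] , (((u≢v ∷ []) ∷ [] ∷ []) , λ q _ → length≥1 q u≢v) , ([] ∷ [])
      where
      u≢v : (i , x) ≢ (j , y)
      u≢v eq = i≢j (cong proj₁ eq)
    ... | yes refl with x F.≟ y
    ...   | yes refl = [] , (([] ∷ []) , λ q _ → z≤n) , []
    ...   | no x≢y with sameClass i x y x≢y
    ...     | w , a , b , rainbow =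
                step w a (step (i , y) b []) ,
                (distinct3 u≢w u≢v w≢v , λ q _ → length≥2 q u≢v (λ u~v → u~v refl)) ,
                rainbow
      where
      u≢w : (i , x) ≢ w
      u≢w eq = a (cong proj₁ eq)
      w≢v : w ≢ (i , y)
      w≢v eq = b (cong proj₁ eq)
      u≢v : (i , x) ≢ (i , y)
      u≢v refl = x≢y refl

  singletonClasses : (∀ i → ns i ≤ 1) → StronglyTotalRainbowConnectable A 1
  singletonClasses small = strongFromSameClass monochrome noPairs
    where
    monochrome : TotalColouring A 1
    monochrome = record { vcol = λ _ → zero ; ecol = λ _ _ _ → zero ; ecol-sym = λ _ _ _ _ → refl }
    noPairs : SameClassRainbow monochrome
    noPairs i x y x≢y = ⊥-elim (x≢y (FP.toℕ-injective (trans (isZero x) (sym (isZero y)))))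
      where
      isZero : (z : Fin (ns i)) → toℕ z ≡ 0
      isZero z = n<1⇒n≡0 (<-≤-trans (FP.toℕ<n z) (small i))

-- A number a < r^m is written with its most significant
-- digit at position zero; the digit at a position j of rank ρ (the exponent of r it
-- stands for) is swapped 0 ↔ 1 when the part of a below it equals ρ.  This is still a
-- bijection onto words, and now the word of a < m has 1 at rank a and 0 at higher ranks.
module BumpedDigits (r₂ : ℕ) where
  r : ℕ
  r = suc (suc r₂)

  bump : Fin r → Fin r
  bump zero = suc zero
  bump (suc zero) = zero
  bump (suc (suc x)) = suc (suc x)

  bump-injective : ∀ {x y} → bump x ≡ bump y → x ≡ y
  bump-injective {zero} {zero} _ = refl
  bump-injective {zero} {suc zero} ()
  bump-injective {zero} {suc (suc y)} ()
  bump-injective {suc zero} {zero} ()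
  bump-injective {suc zero} {suc zero} _ = refl
  bump-injective {suc zero} {suc (suc y)} ()
  bump-injective {suc (suc x)} {zero} ()
  bump-injective {suc (suc x)} {suc zero} ()
  bump-injective {suc (suc x)} {suc (suc y)} eq = eq

  bumpWhen : ℕ → ℕ → Fin r → Fin r
  bumpWhen x y d with x ≟ y
  ... | yes _ = bump d
  ... | no _ = d

  bumpWhen-injective : ∀ x y {d d'} → bumpWhen x y d ≡ bumpWhen x y d' → d ≡ d'
  bumpWhen-injective x y eq with x ≟ y
  ... | yes _ = bump-injective eq
  ... | no _ = eq

  bumpWhen-equal : ∀ x d → bumpWhen x x d ≡ bump d
  bumpWhen-equal x d with x ≟ x
  ... | yes _ = refl
  ... | no x≢x = ⊥-elim (x≢x refl)

  bumpWhen-distinct : ∀ x y d → x ≢ y → bumpWhen x y d ≡ d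
  bumpWhen-distinct x y d x≢y with x ≟ y
  ... | yes x≡y = ⊥-elim (x≢y x≡y)
  ... | no _ = refl

  -- the rank of a position: position zero of Fin (suc m) stands for r^m
  rank : ∀ {m} → Fin m → ℕ
  rank {suc m} zero = m
  rank {suc m} (suc j) = rank j

  rank< : ∀ {m} (j : Fin m) → rank j < m
  rank< {suc m} zero = ≤-refl
  rank< {suc m} (suc j) = m<n⇒m<1+n (rank< j)

  rank-injective : ∀ {m} {j j' : Fin m} → rank j ≡ rank j' → j ≡ j'
  rank-injective {suc m} {zero} {zero} _ = refl
  rank-injective {suc m} {zero} {suc j'} eq = ⊥-elim (<-irrefl (sym eq) (rank< j'))
  rank-injective {suc m} {suc j} {zero} eq = ⊥-elim (<-irrefl eq (rank< j))
  rank-injective {suc m} {suc j} {suc j'} eq = cong suc (rank-injective eq)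

  digits : ∀ m → Fin (r ^ m) → Fin m → Fin r
  digits (suc m) a zero = bumpWhen (toℕ (remainder {r} (r ^ m) a)) m (quotient (r ^ m) a)
  digits (suc m) a (suc j) = digits m (remainder {r} (r ^ m) a) j

  digits-injective : ∀ m {a b : Fin (r ^ m)} → (∀ j → digits m a j ≡ digits m b j) → a ≡ b
  digits-injective zero {zero} {zero} _ = refl
  digits-injective (suc m) {a} {b} same = begin
    a                                                     ≡⟨ FP.combine-remQuot {r} (r ^ m) a ⟨
    combine (quotient (r ^ m) a) (remainder {r} (r ^ m) a) ≡⟨ cong₂ combine top lower ⟩
    combine (quotient (r ^ m) b) (remainder {r} (r ^ m) b) ≡⟨ FP.combine-remQuot {r} (r ^ m) b ⟩
    b                                                     ∎
    where
    open ≡-Reasoning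
    lower : remainder {r} (r ^ m) a ≡ remainder {r} (r ^ m) b
    lower = digits-injective m (λ j → same (suc j))
    top : quotient (r ^ m) a ≡ quotient (r ^ m) b
    top = bumpWhen-injective (toℕ (remainder {r} (r ^ m) a)) m
            (trans (same zero) (cong (λ l → bumpWhen (toℕ l) m (quotient (r ^ m) b)) (sym lower)))

  m<r^m : ∀ m → m < r ^ m
  m<r^m zero = s≤s z≤n
  m<r^m (suc m) = begin-strict
    suc m          ≤⟨ m<r^m m ⟩
    r ^ m          <⟨ m<m+n (r ^ m) (m^n>0 r m) ⟩
    r ^ m + r ^ m  ≤⟨ +-monoʳ-≤ (r ^ m) (m≤m+n (r ^ m) _) ⟩
    r * r ^ m      ∎
    where open ≤-Reasoning

  belowTop : ∀ m (a : Fin (r ^ suc m)) → toℕ a < r ^ m →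
    quotient (r ^ m) a ≡ zero × toℕ (remainder {r} (r ^ m) a) ≡ toℕ a
  belowTop m a a< = split (quotient (r ^ m) a) (remainder {r} (r ^ m) a) (FP.combine-remQuot {r} (r ^ m) a)
    where
    split : ∀ h l → combine h l ≡ a → h ≡ zero × toℕ l ≡ toℕ a
    split zero l recombine = refl , (begin
      toℕ l                        ≡⟨ cong (_+ toℕ l) (*-zeroʳ (r ^ m)) ⟨
      r ^ m * 0 + toℕ l            ≡⟨ FP.toℕ-combine {r} zero l ⟨
      toℕ (combine {r} zero l)     ≡⟨ cong toℕ recombine ⟩
      toℕ a                        ∎)
      where open ≡-Reasoning
    split (suc h) l recombine = ⊥-elim (<⇒≱ a< (begin
      r ^ m                             ≤⟨ m≤m+n (r ^ m) _ ⟩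
      r ^ m + (r ^ m * toℕ h + toℕ l)   ≡⟨ +-assoc (r ^ m) _ _ ⟨
      r ^ m + r ^ m * toℕ h + toℕ l     ≡⟨ cong (_+ toℕ l) (*-suc (r ^ m) (toℕ h)) ⟨
      r ^ m * suc (toℕ h) + toℕ l       ≡⟨ FP.toℕ-combine {r} (suc h) l ⟨
      toℕ (combine (suc h) l)           ≡⟨ cong toℕ recombine ⟩
      toℕ a                             ∎))
      where open ≤-Reasoning

  digits-above : ∀ m (a : Fin (r ^ m)) (j : Fin m) → toℕ a < rank j → digits m a j ≡ zero
  digits-above (suc m) a zero a<m
    with belowTop m a (<-trans a<m (m<r^m m))
  ... | top≡0 , lower≡a = trans (bumpWhen-distinct _ m _ lower≢m) top≡0
    where
    lower≢m : toℕ (remainder {r} (r ^ m) a) ≢ m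
    lower≢m eq = <-irrefl (trans (sym lower≡a) eq) a<m
  digits-above (suc m) a (suc j) a<rank
    with belowTop m a (<-trans a<rank (<-trans (rank< j) (m<r^m m)))
  ... | _ , lower≡a = digits-above m _ j (subst (_< rank j) (sym lower≡a) a<rank)

  digits-at : ∀ m (a : Fin (r ^ m)) (j : Fin m) → toℕ a ≡ rank j → digits m a j ≡ suc zero
  digits-at (suc m) a zero a≡m
    with belowTop m a (subst (_< r ^ m) (sym a≡m) (m<r^m m))
  ... | top≡0 , lower≡a = begin
    bumpWhen (toℕ (remainder {r} (r ^ m) a)) m (quotient (r ^ m) a)
      ≡⟨ cong₂ (λ l h → bumpWhen l m h) (trans lower≡a a≡m) top≡0 ⟩
    bumpWhen m m zero
      ≡⟨ bumpWhen-equal m zero ⟩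
    suc zero ∎
    where open ≡-Reasoning
  digits-at (suc m) a (suc j) a≡rank
    with belowTop m a (subst (_< r ^ m) (sym a≡rank) (<-trans (rank< j) (m<r^m m)))
  ... | _ , lower≡a = digits-at m _ j (trans lower≡a a≡rank)

module WithBigClass {s : ℕ} (ns : Fin (suc s) → ℕ) where
  open Multipartite ns
  open SumEncoding

  big : Fin (suc s)
  big = fromℕ s

  n : ℕ
  n = ns big

  sizes : Fin s → ℕ
  sizes i = ns (inject₁ i)

  m : ℕ
  m = sumFin sizes

  big≢small : (i : Fin s) → big ≢ inject₁ i
  big≢small i = FP.fromℕ≢inject₁

  record SeparatingCode (k : ℕ) : Set where
    field
      word : Fin n → Fin m → Fin k
      separatesBig : ∀ a a' → a ≢ a' → Σ (Fin m) λ P → word a P ≢ word a' P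
      separatesSmall : ∀ i (x y : Fin (sizes i)) → x ≢ y →
        Σ (Fin n) λ a → word a (encode sizes i x) ≢ word a (encode sizes i y)

  module CodeColouring {k : ℕ} (code : SeparatingCode k) where
    open SeparatingCode code

    colourBetween : ∀ {i j} → LastView i → Fin (ns i) → LastView j → Fin (ns j) → Fin (suc k)
    colourBetween last a last b = zero
    colourBetween last a (earlier j) y = suc (word a (encode sizes j y))
    colourBetween (earlier i) x last b = suc (word b (encode sizes i x))
    colourBetween (earlier i) x (earlier j) y = zero

    colourBetween-sym : ∀ {i j} (vi : LastView i) x (vj : LastView j) y →
      colourBetween vi x vj y ≡ colourBetween vj y vi x
    colourBetween-sym last a last b = refl
    colourBetween-sym last a (earlier j) y = refl
    colourBetween-sym (earlier i) x last b = refl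
    colourBetween-sym (earlier i) x (earlier j) y = refl

    edgeColour : V → V → Fin (suc k)
    edgeColour (i , x) (j , y) = colourBetween (lastView i) x (lastView j) y

    colouring : TotalColouring A (suc k)
    colouring = record
      { vcol = λ _ → zero
      ; ecol = λ u v _ → edgeColour u v
      ; ecol-sym = λ { (i , x) (j , y) _ _ → colourBetween-sym (lastView i) x (lastView j) y } }

    edge-big-small : ∀ a j z → edgeColour (big , a) (inject₁ j , z) ≡ suc (word a (encode sizes j z))
    edge-big-small a j z rewrite lastView-last s | lastView-earlier j = refl

    edge-small-big : ∀ j z a → edgeColour (inject₁ j , z) (big , a) ≡ suc (word a (encode sizes j z))
    edge-small-big j z a rewrite lastView-last s | lastView-earlier j = refl

    rainbowAroundZero : ∀ {e f : Fin k} → e ≢ f → Unique (suc e ∷ zero ∷ suc f ∷ [])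
    rainbowAroundZero e≢f = distinct3 (λ ()) (λ eq → e≢f (FP.suc-injective eq)) (λ ())

    -- Big vertices x ≠ y meet through a small vertex where their words differ; small
    -- vertices x ≠ y meet through a big vertex whose word tells them apart.
    sameClass : SameClassRainbow colouring
    sameClass i = byView (lastView i)
      where
      byView : ∀ {i} → LastView i → (x y : Fin (ns i)) → x ≢ y → Σ V λ w → RainbowVia colouring (i , x) w (i , y)
      byView last x y x≢y with separatesBig x y x≢y
      ... | P , differ with decode sizes P | encode-decode sizes P
      ...   | (j , z) | encodes-P =
        (inject₁ j , z) , big≢small j , adj-sym {big , x} {inject₁ j , z} (big≢small j) ,
        subst₂ (λ e f → Unique (e ∷ zero ∷ f ∷ [])) (sym (edge-big-small x j z)) (sym (edge-small-big j z y))
          (rainbowAroundZero (subst (λ Q → word x Q ≢ word y Q) (sym encodes-P) differ))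
      byView (earlier j) x y x≢y with separatesSmall j x y x≢y
      ... | a , differ =
        (big , a) , adj-sym {big , a} {inject₁ j , x} (big≢small j) , big≢small j ,
        subst₂ (λ e f → Unique (e ∷ zero ∷ f ∷ [])) (sym (edge-small-big j x a)) (sym (edge-big-small a j y))
          (rainbowAroundZero differ)

  codeColouring : ∀ {k} → SeparatingCode k → StronglyTotalRainbowConnectable A (suc k)
  codeColouring code = strongFromSameClass colouring sameClass
    where open CodeColouring code

  module LowerBounds (nonempty : ∀ i → 1 ≤ ns i) (i₀ : Fin s) where
    w₀ : V
    w₀ = inject₁ i₀ , fromℕ< (nonempty (inject₁ i₀))

    noColouring0 : ¬ StronglyTotalRainbowConnectable A 0
    noColouring0 (c , _) with TotalColouring.vcol c w₀
    ... | ()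

    -- Distinct big vertices are at distance 2 (via w₀), so their rainbow geodesic has
    -- a middle vertex.
    bigPairMiddle : ∀ {k} (st : StronglyTotalRainbowConnectable A k) → ∀ {a a'} → a ≢ a' →
      Σ V λ w → RainbowVia (proj₁ st) (big , a) w (big , a')
    bigPairMiddle (c , geodesics) {a} {a'} a≢a' with geodesics (big , a) (big , a')
    ... | p , (_ , shortest) , rainbow =
      rainbowMiddle c p (shortest viaW₀ viaW₀-path) u≢v (λ u~v → u~v refl) rainbow
      where
      u≢v : (big , a) ≢ (big , a')
      u≢v refl = a≢a' refl
      viaW₀ : Walk A (big , a) (big , a')
      viaW₀ = step w₀ (big≢small i₀) (step (big , a') (adj-sym {big , a'} {w₀} (big≢small i₀)) [])
      viaW₀-path : IsPath A viaW₀
      viaW₀-path = distinct3 (λ eq → big≢small i₀ (cong proj₁ eq)) u≢v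
                             (λ eq → big≢small i₀ (sym (cong proj₁ eq)))

    atLeastThree : ∀ {k} → 2 ≤ n → k ≤ 2 → ¬ StronglyTotalRainbowConnectable A k
    atLeastThree n≥2 k≤2 st with bigPairMiddle st first≢second
      where
      first≢second : fromℕ< {0} (≤-trans (s≤s z≤n) n≥2) ≢ fromℕ< {1} n≥2
      first≢second eq with trans (sym (FP.toℕ-fromℕ< {0} (≤-trans (s≤s z≤n) n≥2)))
                                 (trans (cong toℕ eq) (FP.toℕ-fromℕ< {1} n≥2))
      ... | ()
    ... | _ , _ , _ , rainbow = noThreeDistinct k≤2 rainbow

    module _ {k : ℕ} (c : TotalColouring A k) where
      open TotalColouring c

      edgeToSmall : Fin n → (i : Fin s) → Fin (sizes i) → Fin k
      edgeToSmall a i z = ecol (big , a) (inject₁ i , z) (big≢small i)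

      middleSeparates : (∀ u v → Σ (Walk A u v) λ p → IsGeodesic A p × IsTotalRainbow A c p) →
        ∀ {a a'} → a ≢ a' → Σ (Fin s) λ i → Σ (Fin (sizes i)) λ z →
          let v = vcol (inject₁ i , z) in
          v ≢ edgeToSmall a i z × v ≢ edgeToSmall a' i z × edgeToSmall a i z ≢ edgeToSmall a' i z
      middleSeparates geodesics a≢a' with bigPairMiddle (c , geodesics) a≢a'
      ... | (j , z) , α , β , rainbow with lastView j
      ...   | last = ⊥-elim (α refl)
      ...   | earlier i with rainbow
      ...     | (e≢v ∷ e≢e' ∷ []) ∷ (v≢e' ∷ []) ∷ [] ∷ [] =
        i , z , (λ eq → e≢v (trans fromBig (sym eq))) ,
                (λ eq → v≢e' (trans eq toBig)) ,
                (λ eq → e≢e' (trans fromBig (trans eq toBig)))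
        where
        fromBig : ecol (big , _) (inject₁ i , z) α ≡ edgeToSmall _ i z
        fromBig = ecol-irrelevant c (λ {u} {w} → adj-sym {u} {w}) α (big≢small i)
        toBig : edgeToSmall _ i z ≡ ecol (inject₁ i , z) (big , _) β
        toBig = ecol-sym _ _ (big≢small i) β

    -- With b + 2 colours, relabelled edge colours towards the small vertices give
    -- pairwise distinct words for the big vertices, so n ≤ (b+1)^m.
    bigSize≤power : ∀ {b} → StronglyTotalRainbowConnectable A (suc (suc b)) → n ≤ suc b ^ m
    bigSize≤power {b} (c , geodesics) = distinctWords⇒≤ word separated
      where
      open TotalColouring c
      smallWord : Fin n → (Σ (Fin s) λ i → Fin (sizes i)) → Fin (suc b)
      smallWord a (i , z) = relabel (vcol (inject₁ i , z)) (edgeToSmall c a i z)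
      word : Fin n → Fin m → Fin (suc b)
      word a P = smallWord a (decode sizes P)
      separated : ∀ a a' → a ≢ a' → Σ (Fin m) λ P → word a P ≢ word a' P
      separated a a' a≢a' with middleSeparates c geodesics a≢a'
      ... | i , z , v≢e , v≢e' , e≢e' =
        encode sizes i z , λ eq → e≢e' (relabel-injective v≢e v≢e'
          (subst (λ d → smallWord a d ≡ smallWord a' d) (decode-encode sizes i z) eq))

  -- For n < m, with no class larger than n: word a P = 1 iff P ≡ a (mod n).  Small
  -- vertices of one class are consecutive and fewer than n, so have distinct residues.
  residueCode : (∀ i → sizes i ≤ n) → 2 ≤ n → n < m → SeparatingCode 2
  residueCode classes≤n n≥2 n<m = record
    { word = word ; separatesBig = separatesBig ; separatesSmall = separatesSmall }
    where
    instance
      n≢0 : NonZero n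
      n≢0 = >-nonZero (≤-trans (s≤s z≤n) n≥2)

    word : Fin n → Fin m → Fin 2
    word a P = indicator (toℕ a ≟ toℕ P % n)

    separatesBig : ∀ a a' → a ≢ a' → Σ (Fin m) λ P → word a P ≢ word a' P
    separatesBig a a' a≢a' =
      P , indicator-differs (toℕ a ≟ _) (toℕ a' ≟ _) a≡P
            (λ a'≡P → a≢a' (FP.toℕ-injective (trans a≡P (sym a'≡P))))
      where
      a<m = <-trans (FP.toℕ<n a) n<m
      P : Fin m
      P = fromℕ< a<m
      a≡P : toℕ a ≡ toℕ P % n
      a≡P = sym (trans (cong (_% n) (FP.toℕ-fromℕ< a<m)) (m<n⇒m%n≡m (FP.toℕ<n a)))

    separatesSmall : ∀ i (x y : Fin (sizes i)) → x ≢ y →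
      Σ (Fin n) λ a → word a (encode sizes i x) ≢ word a (encode sizes i y)
    separatesSmall i x y x≢y = a , indicator-differs (toℕ a ≟ _) (toℕ a ≟ _) a≡P a≢Q
      where
      P = encode sizes i x
      Q = encode sizes i y
      a : Fin n
      a = fromℕ< (m%n<n (toℕ P) n)
      a≡P : toℕ a ≡ toℕ P % n
      a≡P = FP.toℕ-fromℕ< (m%n<n (toℕ P) n)
      a≢Q : toℕ a ≢ toℕ Q % n
      a≢Q a≡Q = residue-injective n (offset sizes i)
        (<-≤-trans (FP.toℕ<n x) (classes≤n i)) (<-≤-trans (FP.toℕ<n y) (classes≤n i))
        (λ eq → x≢y (FP.toℕ-injective eq))
        (subst₂ (λ p q → p % n ≡ q % n) (toℕ-encode sizes i x) (toℕ-encode sizes i y)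
          (trans (sym a≡P) a≡Q))

  -- For m ≤ n ≤ r^m: word a P = the bumped base-r digit of a at position P.  Big
  -- vertices get distinct numbers, and the big vertex numbered rank P marks P against
  -- every position of higher rank.
  digitCode : ∀ r₂ → m ≤ n → n ≤ suc (suc r₂) ^ m → SeparatingCode (suc (suc r₂))
  digitCode r₂ m≤n n≤r^m = record
    { word = word ; separatesBig = separatesBig ; separatesSmall = separatesSmall }
    where
    open BumpedDigits r₂

    number : Fin n → Fin (r ^ m)
    number a = inject≤ a n≤r^m

    word : Fin n → Fin m → Fin r
    word a = digits m (number a)

    separatesBig : ∀ a a' → a ≢ a' → Σ (Fin m) λ P → word a P ≢ word a' P
    separatesBig a a' a≢a' = FP.¬∀⟶∃¬ m (λ P → word a P ≡ word a' P) (λ P → word a P F.≟ word a' P)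
      (λ same → a≢a' (FP.inject≤-injective n≤r^m n≤r^m a a' (digits-injective m same)))

    markRank : ∀ P Q → rank P < rank Q → Σ (Fin n) λ a → word a P ≢ word a Q
    markRank P Q P<Q = a , λ eq → 1≢0 (trans (sym (digits-at m (number a) P a≡P))
                                         (trans eq (digits-above m (number a) Q (subst (_< rank Q) (sym a≡P) P<Q))))
      where
      rankP<n = <-≤-trans (rank< P) m≤n
      a : Fin n
      a = fromℕ< rankP<n
      a≡P : toℕ (number a) ≡ rank P
      a≡P = trans (FP.toℕ-inject≤ a n≤r^m) (FP.toℕ-fromℕ< rankP<n)
      1≢0 : suc zero ≢ zero {suc r₂}
      1≢0 ()

    separatesSmall : ∀ i (x y : Fin (sizes i)) → x ≢ y →
      Σ (Fin n) λ a → word a (encode sizes i x) ≢ word a (encode sizes i y)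
    separatesSmall i x y x≢y with <-cmp (rank (encode sizes i x)) (rank (encode sizes i y))
    ... | tri< P<Q _ _ = markRank _ _ P<Q
    ... | tri≈ _ P≡Q _ = ⊥-elim (x≢y (encode-injective sizes i (rank-injective P≡Q)))
    ... | tri> _ _ Q<P with markRank _ _ Q<P
    ...   | a , differ = a , ≢-sym differ

theorem3p9 : (s : ℕ) → 2 ≤ s → (ns : Fin (suc s) → ℕ) →
    (∀ i → 1 ≤ ns i) → (∀ i j → i ≤ᶠ j → ns i ≤ ns j) →
    let m = sumFin (λ (i : Fin s) → ns (inject₁ i))
        n = ns (fromℕ s)
    in (n ≡ 1 → StrcIs (MAdj ns) 1)
     × (n ≥ 2 → m > n → StrcIs (MAdj ns) 3)
     × (m ≤ n → ∀ r → IsCeilRoot m n r → StrcIs (MAdj ns) (suc r))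
theorem3p9 zero ()
theorem3p9 (suc zero) (s≤s ())
theorem3p9 (suc (suc _)) _ ns nonempty monotone = oneColour , threeColours , rootColours
  where
  open Multipartite ns
  open WithBigClass ns
  open LowerBounds nonempty zero

  classes≤n : ∀ i → ns i ≤ n
  classes≤n i = monotone i big (FP.≤fromℕ i)

  oneColour : n ≡ 1 → StrcIs A 1
  oneColour n≡1 = singletonClasses (λ i → subst (ns i ≤_) n≡1 (classes≤n i)) ,
                  λ { zero _ → noColouring0 ; (suc _) (s≤s ()) }

  threeColours : n ≥ 2 → m > n → StrcIs A 3
  threeColours n≥2 n<m = codeColouring (residueCode (λ i → classes≤n (inject₁ i)) n≥2 n<m) ,
                         λ k k<3 → atLeastThree n≥2 (s≤s⁻¹ k<3)

  -- there are at least two small classes, all nonempty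
  m≥2 : 2 ≤ m
  m≥2 = ≤-trans (s≤s (s≤s z≤n)) (SumEncoding.classes≤sum sizes (λ i → nonempty (inject₁ i)))

  rootColours : m ≤ n → ∀ r → IsCeilRoot m n r → StrcIs A (suc r)
  rootColours m≤n r (n≤r^m , minimal) with ceilRoot≥2 {m} (≤-trans m≥2 m≤n) n≤r^m
  ... | s≤s (s≤s _) = codeColouring (digitCode _ m≤n n≤r^m) , fewer
    where
    fewer : ∀ k → k < suc r → ¬ StronglyTotalRainbowConnectable A k
    fewer zero _ = noColouring0
    fewer (suc zero) _ = atLeastThree (≤-trans m≥2 m≤n) (s≤s z≤n)
    fewer (suc (suc b)) k<r+1 st = minimal (suc b) (s≤s⁻¹ k<r+1) (bigSize≤power st)
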